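{- Let $k$ be a positive integer and let $p$ be a $k$-radius prime. Then there exists a $p$-ary $k$-radius sequence of length $\frac{p-1}{2k}(p+k-1)+1$. In particular, for fixed $k$, $f_k(p)=\frac{1}{k}\binom{p}{2}+O(p)$ as $p$ ranges over $k$-radius primes.
   Context: An $n$-ary $k$-radius sequence is a finite sequence $a_0,\ldots,a_{m-1}$ of elements of $\{0,\ldots,n-1\}$ such that for all distinct $x,y$ in this set there exist $i,j$ with $a_i=x$, $a_j=y$, $|i-j|\le k$; $f_k(n)$ is the shortest length of such a sequence. A prime $p$ is a $k$-radius prime if (1) $p\equiv 1\pmod{2k}$, and (2) the elements $1^{(p-1)/k},2^{(p-1)/k},\ldots,k^{(p-1)/k}$ of $\mathbb{Z}_p^*$ are pairwise distinct. -}

module Defs where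

open import Data.Nat using (ℕ; zero; suc; _+_; _*_; _∸_; _^_; _≤_; _<_; NonZero; ∣_-_∣)
open import Data.Nat.DivMod using (_/_)
open import Data.Nat.Divisibility using (_∣_)
open import Data.Nat.Primality using (Prime)
open import Data.Fin using (Fin; toℕ)
open import Data.List using (List; length; lookup)
open import Data.Product using (_×_; ∃; ∃-syntax)
open import Relation.Binary.PropositionalEquality using (_≡_; _≢_)
import Data.Empty

IsRadiusSeq : (n k : ℕ) → List (Fin n) → Set
IsRadiusSeq n k s =
  (x y : Fin n) → x ≢ y →
  ∃[ i ] ∃[ j ] (lookup s i ≡ x × lookup s j ≡ y × ∣ toℕ i - toℕ j ∣ ≤ k)

ModEq : ℕ → ℕ → ℕ → Set
ModEq p x y = p ∣ ∣ x - y ∣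

IsRadiusPrime : (k : ℕ) → .{{NonZero k}} → ℕ → Set
IsRadiusPrime k p =
  Prime p × ModEq (2 * k) p 1 ×
  ((a b : ℕ) → 1 ≤ a → a ≤ k → 1 ≤ b → b ≤ k → a ≢ b →
     ¬ModEq p (a ^ ((p ∸ 1) / k)) (b ^ ((p ∸ 1) / k)))
  where
  ¬ModEq : ℕ → ℕ → ℕ → Set
  ¬ModEq q x y = ModEq q x y → Data.Empty.⊥

module Submission where

-- Let e = 2t.  The residues 1^e, …, k^e are k distinct k-th roots
-- of unity mod p, hence all of them (Lagrange), so every δ ≢ 0 has
-- δ^e ≡ i^e for some 1 ≤ i ≤ k, and then δ ≡ ±i·d with d one of the t
-- e-th roots of unity in [1, (p-1)/2].  For each such d the sequence
-- contains an arithmetic progression with difference d through all p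
-- residues and k steps beyond; it places x next to x + i·d within
-- distance i ≤ k.  Consecutive progressions share their boundary term.

open import Data.Nat.Base using (ℕ; zero; suc; z≤n; s≤s)
import Data.Nat.Base as Nat
import Data.Nat.Properties as ℕₚ
import Data.Nat.Divisibility as ℕ∣
import Data.Nat.DivMod as NatDM
open import Data.Nat.Primality using (Prime; euclidsLemma; prime⇒nonZero; prime⇒nonTrivial)
open import Data.Integer.Base using (ℤ)
import Data.Integer.Base as Int
import Data.Integer.Properties as Intₚ
import Data.Integer.Divisibility.Signed as ℤ∣
import Data.Integer.DivMod as IntDM
open import Data.Integer.Tactic.RingSolver using (solve-∀)
open import Data.Product using (∃; ∃-syntax; _×_; _,_; proj₁; proj₂)
open import Data.Sum as Sum using (_⊎_; inj₁; inj₂)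
open import Defs using (ModEq; IsRadiusSeq; IsRadiusPrime)
open import Data.List.Membership.Propositional using (_∈_)
open import Data.Empty using (⊥-elim)
open import Relation.Nullary using (¬_; Dec; yes; no)
open import Function.Base using (_∘_)
open import Relation.Binary.Bundles using (Setoid)
open import Relation.Binary.PropositionalEquality
  using (_≡_; _≢_; refl; sym; trans; cong; cong₂; subst; subst₂; module ≡-Reasoning)

module PrimeFacts (p : ℕ) (prime : Prime p) where

  1<p : 1 Nat.< p
  1<p = Nat.nonTrivial⇒n>1 p {{prime⇒nonTrivial prime}}

  p≡1+[p-1] : p ≡ suc (p Nat.∸ 1)
  p≡1+[p-1] = sym (ℕₚ.suc-pred p {{prime⇒nonZero prime}})

  instance
    p≢0 : Nat.NonZero p
    p≢0 = prime⇒nonZero prime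

module Congruence (p : ℕ) where

  open Int using (+_; _+_; _*_; _-_; -_; _^_)
  open ℤ∣ using (divides; ∣m∣n⇒∣m+n; ∣m⇒∣-m; ∣n⇒∣m*n)

  -- a ≋ b : "a ≡ b (mod p)".  A record rather than a bare divisibility
  -- statement, so that a and b can be recovered by unification.
  infix 4 _≋_ _≉_
  record _≋_ (a b : ℤ) : Set where
    constructor mod
    field p∣a-b : + p ℤ∣.∣ a - b

  _≉_ : ℤ → ℤ → Set
  a ≉ b = ¬ (a ≋ b)

  private
    resp : ∀ {x y} → x ≡ y → + p ℤ∣.∣ x → + p ℤ∣.∣ y
    resp eq d = subst (+ p ℤ∣.∣_) eq d

  ≋-refl : ∀ {a} → a ≋ a
  ≋-refl {a} = mod (resp (sym (Intₚ.+-inverseʳ a)) (divides (+ 0) refl))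

  ≡⇒≋ : ∀ {a b} → a ≡ b → a ≋ b
  ≡⇒≋ refl = ≋-refl

  ≋-sym : ∀ {a b} → a ≋ b → b ≋ a
  ≋-sym {a} {b} (mod d) = mod (resp (swap a b) (∣m⇒∣-m d))
    where swap : ∀ a b → - (a - b) ≡ b - a
          swap = solve-∀

  ≋-trans : ∀ {a b c} → a ≋ b → b ≋ c → a ≋ c
  ≋-trans {a} {b} {c} (mod d) (mod e) = mod (resp (chain a b c) (∣m∣n⇒∣m+n d e))
    where chain : ∀ a b c → (a - b) + (b - c) ≡ a - c
          chain = solve-∀

  setoid : Setoid _ _
  setoid = record
    { Carrier = ℤ ; _≈_ = _≋_
    ; isEquivalence = record { refl = ≋-refl ; sym = ≋-sym ; trans = ≋-trans } }

  +-cong : ∀ {a b c d} → a ≋ c → b ≋ d → a + b ≋ c + d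
  +-cong {a} {b} {c} {d} (mod x) (mod y) = mod (resp (split a b c d) (∣m∣n⇒∣m+n x y))
    where split : ∀ a b c d → (a - c) + (b - d) ≡ (a + b) - (c + d)
          split = solve-∀

  *-cong : ∀ {a b c d} → a ≋ c → b ≋ d → a * b ≋ c * d
  *-cong {a} {b} {c} {d} (mod x) (mod y) =
    mod (resp (split a b c d) (∣m∣n⇒∣m+n (∣n⇒∣m*n b x) (∣n⇒∣m*n c y)))
    where split : ∀ a b c d → b * (a - c) + c * (b - d) ≡ a * b - c * d
          split = solve-∀

  neg-cong : ∀ {a b} → a ≋ b → - a ≋ - b
  neg-cong {a} {b} (mod x) = mod (resp (split a b) (∣m⇒∣-m x))
    where split : ∀ a b → - (a - b) ≡ - a - - b
          split = solve-∀

  -‿cong : ∀ {a b c d} → a ≋ c → b ≋ d → a - b ≋ c - d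
  -‿cong x y = +-cong x (neg-cong y)

  ^-cong : ∀ {a b} n → a ≋ b → a ^ n ≋ b ^ n
  ^-cong zero    _ = ≋-refl
  ^-cong (suc n) x = *-cong x (^-cong n x)

  ∣⇒≋0 : ∀ {a} → + p ℤ∣.∣ a → a ≋ + 0
  ∣⇒≋0 {a} d = mod (resp (sym (Intₚ.+-identityʳ a)) d)

  ≋0⇒∣ : ∀ {a} → a ≋ + 0 → + p ℤ∣.∣ a
  ≋0⇒∣ {a} (mod d) = resp (Intₚ.+-identityʳ a) d

  p≋0 : + p ≋ + 0
  p≋0 = ∣⇒≋0 ℤ∣.∣-refl

  -≋0⇒≋ : ∀ {a b} → a - b ≋ + 0 → a ≋ b
  -≋0⇒≋ a-b≋0 = mod (≋0⇒∣ a-b≋0)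

  private
    ∣+a-+b∣ : ∀ a b → Int.∣ + a - + b ∣ ≡ Nat.∣ a - b ∣
    ∣+a-+b∣ a b with ℕₚ.≤-total a b
    ... | inj₁ a≤b = trans (cong Int.∣_∣ (Intₚ.m-n≡m⊖n a b))
                       (trans (Intₚ.∣⊖∣-≤ a≤b) (sym (ℕₚ.m≤n⇒∣m-n∣≡n∸m a≤b)))
    ... | inj₂ b≤a = trans (cong Int.∣_∣ (Intₚ.m-n≡m⊖n a b))
                       (trans (Intₚ.∣m⊖n∣≡∣n⊖m∣ a b)
                       (trans (Intₚ.∣⊖∣-≤ b≤a) (sym (ℕₚ.m≤n⇒∣n-m∣≡n∸m b≤a))))

  ≋⇒ModEq : ∀ {a b} → + a ≋ + b → ModEq p a b
  ≋⇒ModEq {a} {b} (mod d) = subst (p ℕ∣.∣_) (∣+a-+b∣ a b) (ℤ∣.∣⇒∣ᵤ d)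

  canonical : ∀ {a b} → a Nat.< p → b Nat.< p → + a ≋ + b → a ≡ b
  canonical {a} {b} a<p b<p a≋b with Nat.∣ a - b ∣ in eq
  ... | zero  = ℕₚ.∣m-n∣≡0⇒m≡n eq
  ... | suc _ = ⊥-elim (ℕₚ.<⇒≱ (subst (Nat._< p) eq ∣a-b∣<p)
                          (ℕ∣.∣⇒≤ (subst (p ℕ∣.∣_) eq (≋⇒ModEq a≋b))))
    where ∣a-b∣<p = ℕₚ.≤-<-trans (ℕₚ.∣m-n∣≤m⊔n a b) (ℕₚ.⊔-lub a<p b<p)

  positive≉0 : ∀ {a} → 0 Nat.< a → a Nat.< p → + a ≉ + 0
  positive≉0 0<a a<p a≋0 = ℕₚ.<⇒≢ 0<a (sym (canonical a<p (ℕₚ.<-trans 0<a a<p) a≋0))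

  infix 4 _≋?_
  _≋?_ : ∀ a b → Dec (a ≋ b)
  a ≋? b with + p ℤ∣.∣? (a - b)
  ... | yes d = yes (mod d)
  ... | no ¬d = no λ where (mod d) → ¬d d

  module _ .{{_ : Nat.NonZero p}} where

    residue : ℤ → ℕ
    residue a = a IntDM.%ℕ p

    residue<p : ∀ a → residue a Nat.< p
    residue<p a = IntDM.n%ℕd<d a p

    ≋residue : ∀ a → a ≋ + residue a
    ≋residue a = mod (divides (a IntDM./ℕ p) (lemma (residue a) (a IntDM./ℕ p) (IntDM.a≡a%ℕn+[a/ℕn]*n a p)))
      where
      lemma : ∀ {a} r q → a ≡ + r + q * + p → a - + r ≡ q * + p
      lemma r q refl = cancel (+ r) (q * + p)
        where cancel : ∀ r x → (r + x) - r ≡ x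
              cancel = solve-∀

  module _ (prime : Prime p) where

    euclid : ∀ {a b} → a * b ≋ + 0 → a ≋ + 0 ⊎ b ≋ + 0
    euclid {a} {b} ab≋0
      with euclidsLemma Int.∣ a ∣ Int.∣ b ∣ prime
             (subst (p ℕ∣.∣_) (Intₚ.abs-* a b) (ℤ∣.∣⇒∣ᵤ (≋0⇒∣ ab≋0)))
    ... | inj₁ p∣a = inj₁ (∣⇒≋0 (ℤ∣.∣ᵤ⇒∣ p∣a))
    ... | inj₂ p∣b = inj₂ (∣⇒≋0 (ℤ∣.∣ᵤ⇒∣ p∣b))

    cancelˡ : ∀ {a x y} → a ≉ + 0 → a * x ≋ a * y → x ≋ y
    cancelˡ {a} {x} {y} a≉0 (mod d) with euclid (mod (subst (+ p ℤ∣.∣_) (factor a x y) d))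
      where factor : ∀ a x y → a * x - a * y ≡ a * (x - y) - + 0
            factor = solve-∀
    ... | inj₁ a≋0 = ⊥-elim (a≉0 a≋0)
    ... | inj₂ x-y≋0 = -≋0⇒≋ x-y≋0

    1≉0 : + 1 ≉ + 0
    1≉0 1≋0 = ℕₚ.<⇒≱ (PrimeFacts.1<p p prime) (ℕ∣.∣⇒≤ (ℤ∣.∣⇒∣ᵤ (≋0⇒∣ 1≋0)))

-- The freshman's dream (a + 1)^p = a^p + 1 (mod p) for a prime p, stated
-- over ℕ: the binomial expansion of (a + 1)^p has first term 1, last term
-- a^p, and all inner terms divisible by p.
module FreshmansDream (p : ℕ) (prime : Prime p) where

  open import Data.Nat.Base using (_+_; _*_; _∸_; _^_; _≤_; _<_; _!)
  open import Data.Nat.Combinatorics using (_C_; nCk≡n!/k![n-k]!; k![n∸k]!∣n!; nCn≡1)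
  open PrimeFacts p prime using (1<p; p≡1+[p-1])
  open import Data.Fin.Base using (Fin; zero; suc; toℕ; fromℕ; inject₁)
  import Data.Fin.Properties as Finₚ
  import Data.Vec.Functional as Vector
  open import Algebra.Definitions.RawSemiring Nat.+-*-rawSemiring
    using () renaming (_^_ to _^ₛ_; _×_ to _×ₛ_)
  open ℕ∣ using (_∣_; divides)
  import Algebra.Properties.Semiring.Binomial as Binomial
  open ≡-Reasoning

  -- p does not divide m! for m < p, as all factors of m! are below p.
  prime∤! : ∀ m → m < p → ¬ (p ∣ m !)
  prime∤! zero    _     p∣1 = ℕₚ.<⇒≱ 1<p (ℕ∣.∣⇒≤ p∣1)
  prime∤! (suc m) 1+m<p p∣m! with euclidsLemma (suc m) (m !) prime p∣m!
  ... | inj₁ p∣1+m = ℕₚ.<⇒≱ 1+m<p (ℕ∣.∣⇒≤ p∣1+m)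
  ... | inj₂ p∣m!  = prime∤! m (ℕₚ.<-trans (ℕₚ.n<1+n m) 1+m<p) p∣m!

  -- p divides C(p, j) for 0 < j < p, since C(p, j) · j! · (p - j)! = p!.
  prime∣C : ∀ j → 0 < j → j < p → p ∣ p C j
  prime∣C j 0<j j<p with euclidsLemma (p C j) (j ! * (p ∸ j) !) prime p∣C·j!·[p-j]!
    where
    instance _ = ℕₚ._!*_!≢0 j (p ∸ j)
    j!·[p-j]!∣p! = k![n∸k]!∣n! (ℕₚ.<⇒≤ j<p)
    d = j ! * (p ∸ j) !
    C·j!·[p-j]!≡p! : (p C j) * d ≡ p !
    C·j!·[p-j]!≡p! = begin
      (p C j) * d                        ≡⟨ cong (_* d) (nCk≡n!/k![n-k]! (ℕₚ.<⇒≤ j<p)) ⟩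
      (p ! Nat./ d) * d                  ≡⟨ cong (_* d) (ℕ∣.n/m≡quotient j!·[p-j]!∣p!) ⟩
      ℕ∣._∣_.quotient j!·[p-j]!∣p! * d  ≡⟨ ℕ∣.m∣n⇒n≡quotient*m j!·[p-j]!∣p! ⟨
      p !                                ∎
    n∣n! : ∀ n → 0 < n → n ∣ n !
    n∣n! (suc n) _ = ℕ∣.∣m⇒∣m*n (n !) ℕ∣.∣-refl
    p∣p! = n∣n! p (ℕₚ.<-trans (s≤s z≤n) 1<p)
    p∣C·j!·[p-j]! = subst (p ∣_) (sym C·j!·[p-j]!≡p!) p∣p!
  ... | inj₁ p∣C = p∣C
  ... | inj₂ p∣j!·[p-j]! with euclidsLemma (j !) ((p ∸ j) !) prime p∣j!·[p-j]!
  ...   | inj₁ p∣j! = ⊥-elim (prime∤! j j<p p∣j!)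
  ...   | inj₂ p∣[p-j]! = ⊥-elim (prime∤! (p ∸ j) p-j<p p∣[p-j]!)
    where p-j<p = ℕₚ.∸-monoʳ-< {p} {j} {0} 0<j (ℕₚ.<⇒≤ j<p)

  sum-multiples+last : ∀ m (f : Fin (suc m) → ℕ) → (∀ i → p ∣ f (inject₁ i)) →
                       ∃[ M ] (p ∣ M × Vector.foldr _+_ 0 f ≡ M + f (fromℕ m))
  sum-multiples+last zero    f _      = 0 , (p ℕ∣.∣0) , ℕₚ.+-identityʳ (f zero)
  sum-multiples+last (suc m) f p∣init with sum-multiples+last m (f ∘ suc) (p∣init ∘ suc)
  ... | M , p∣M , eq = f zero + M , ℕ∣.∣m∣n⇒∣m+n (p∣init zero) p∣M ,
                       trans (cong (f zero +_) eq) (sym (ℕₚ.+-assoc (f zero) M _))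

  ^ₛ≡^ : ∀ x n → x ^ₛ n ≡ x ^ n
  ^ₛ≡^ x zero    = refl
  ^ₛ≡^ x (suc n) = cong (x *_) (^ₛ≡^ x n)

  ×ₛ≡* : ∀ n x → n ×ₛ x ≡ n * x
  ×ₛ≡* zero    x = refl
  ×ₛ≡* (suc n) x = cong (x +_) (×ₛ≡* n x)

  module _ (m : ℕ) (p∣C : ∀ j → 0 < j → j < suc m → p ∣ suc m C j) (a : ℕ) where
    open Binomial ℕₚ.+-*-semiring a 1 using (binomialTerm; theorem)

    private
      term = binomialTerm (suc m)

      term₀≡1 : term zero ≡ 1
      term₀≡1 = begin
        1 ×ₛ (1 * 1 ^ₛ suc m)  ≡⟨ ×ₛ≡* 1 _ ⟩
        1 * (1 * 1 ^ₛ suc m)   ≡⟨ ℕₚ.*-identityˡ _ ⟩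
        1 * 1 ^ₛ suc m         ≡⟨ ℕₚ.*-identityˡ _ ⟩
        1 ^ₛ suc m             ≡⟨ ^ₛ≡^ 1 (suc m) ⟩
        1 ^ suc m              ≡⟨ ℕₚ.^-zeroˡ (suc m) ⟩
        1                      ∎

      termₙ≡aⁿ : term (suc (fromℕ m)) ≡ a ^ suc m
      termₙ≡aⁿ rewrite Finₚ.toℕ-fromℕ m = begin
        (suc m C suc m) ×ₛ x                           ≡⟨ ×ₛ≡* (suc m C suc m) x ⟩
        (suc m C suc m) * x                            ≡⟨ cong (_* x) (nCn≡1 (suc m)) ⟩
        1 * x                                          ≡⟨ ℕₚ.*-identityˡ x ⟩
        a ^ₛ suc m * 1 ^ₛ (m ∸ m)                      ≡⟨ cong₂ _*_ (^ₛ≡^ a (suc m)) (^ₛ≡^ 1 (m ∸ m)) ⟩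
        a ^ suc m * 1 ^ (m ∸ m)                        ≡⟨ cong (a ^ suc m *_) (ℕₚ.^-zeroˡ (m ∸ m)) ⟩
        a ^ suc m * 1                                  ≡⟨ ℕₚ.*-identityʳ (a ^ suc m) ⟩
        a ^ suc m                                      ∎
        where x = a ^ₛ suc m * 1 ^ₛ (m ∸ m)

      p∣inner : ∀ i → p ∣ term (suc (inject₁ i))
      p∣inner i = subst (p ∣_) (sym (×ₛ≡* (suc m C suc (toℕ (inject₁ i))) _))
                    (ℕ∣.∣m⇒∣m*n _ (p∣C (suc (toℕ (inject₁ i))) (s≤s z≤n) (s≤s i<m)))
        where i<m = subst (_< m) (sym (Finₚ.toℕ-inject₁ i)) (Finₚ.toℕ<n i)

    binomial-mod : ∃[ M ] (p ∣ M × suc a ^ suc m ≡ suc (M + a ^ suc m))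
    binomial-mod with sum-multiples+last m (term ∘ suc) p∣inner
    ... | M , p∣M , sum≡ = M , p∣M , (begin
      suc a ^ suc m                                ≡⟨ cong (_^ suc m) (ℕₚ.+-comm 1 a) ⟩
      (a + 1) ^ suc m                              ≡⟨ ^ₛ≡^ (a + 1) (suc m) ⟨
      (a + 1) ^ₛ suc m                             ≡⟨ theorem (ℕₚ.*-comm a 1) (suc m) ⟩
      term zero + Vector.foldr _+_ 0 (term ∘ suc)  ≡⟨ cong₂ _+_ term₀≡1 sum≡ ⟩
      1 + (M + term (suc (fromℕ m)))               ≡⟨ cong (λ t → suc (M + t)) termₙ≡aⁿ ⟩
      suc (M + a ^ suc m)                          ∎)

  freshman : ∀ a → ∃[ M ] (p ∣ M × suc a ^ p ≡ suc (M + a ^ p))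
  freshman = subst (λ n → ∀ a → ∃[ M ] (p ∣ M × suc a ^ n ≡ suc (M + a ^ n))) (sym p≡1+[p-1])
               (binomial-mod (p ∸ 1) p∣C)
    where p∣C : ∀ j → 0 < j → j < suc (p ∸ 1) → p ∣ suc (p ∸ 1) C j
          p∣C j 0<j j<p = subst (λ n → p ∣ n C j) p≡1+[p-1]
                            (prime∣C j 0<j (subst (j <_) (sym p≡1+[p-1]) j<p))

module Powers where

  open Int using (+_; _*_; -_; _^_)

  +-^ : ∀ m n → + (m Nat.^ n) ≡ (+ m) ^ n
  +-^ m zero    = refl
  +-^ m (suc n) = trans (Intₚ.pos-* m (m Nat.^ n)) (cong (λ x → + m * x) (+-^ m n))

  ^-distrib-* : ∀ a b n → (a * b) ^ n ≡ a ^ n * b ^ n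
  ^-distrib-* a b zero    = refl
  ^-distrib-* a b (suc n) = trans (cong ((a * b) *_) (^-distrib-* a b n)) (shuffle a b (a ^ n) (b ^ n))
    where shuffle : ∀ a b x y → (a * b) * (x * y) ≡ (a * x) * (b * y)
          shuffle = solve-∀

  ^-neg-even : ∀ a t → (- a) ^ (2 Nat.* t) ≡ a ^ (2 Nat.* t)
  ^-neg-even a t = begin
    (- a) ^ (2 Nat.* t)     ≡⟨ Intₚ.^-*-assoc (- a) 2 t ⟨
    ((- a) ^ 2) ^ t         ≡⟨ cong (_^ t) (square a) ⟩
    (a ^ 2) ^ t             ≡⟨ Intₚ.^-*-assoc a 2 t ⟩
    a ^ (2 Nat.* t)         ∎
    where
    open ≡-Reasoning
    -- (- a) ^ 2 ≡ a ^ 2, with the powers unfolded for the solver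
    square : ∀ a → (- a) * ((- a) * Int.1ℤ) ≡ a * (a * Int.1ℤ)
    square = solve-∀

module Fermat (p : ℕ) (prime : Prime p) where

  open Int using (+_; _+_; _*_; _-_; -_; _^_)
  open Congruence p
  open PrimeFacts p prime
  open FreshmansDream p prime using (freshman)
  open Powers using (+-^)
  open import Relation.Binary.Reasoning.Setoid setoid

  fermat-ℕ : ∀ a → (+ a) ^ p ≋ + a
  fermat-ℕ zero = ≡⇒≋ (subst (λ n → (+ 0) ^ n ≡ + 0) (sym p≡1+[p-1]) (Intₚ.*-zeroˡ ((+ 0) ^ (p Nat.∸ 1))))
  fermat-ℕ (suc a) with freshman a
  ... | M , p∣M , eq = begin
    (+ suc a) ^ p                    ≡⟨ +-^ (suc a) p ⟨
    + (suc a Nat.^ p)                ≡⟨ cong +_ eq ⟩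
    + suc (M Nat.+ a Nat.^ p)        ≡⟨ Intₚ.pos-+ 1 (M Nat.+ a Nat.^ p) ⟩
    + 1 + + (M Nat.+ a Nat.^ p)      ≡⟨ cong (λ x → + 1 + x) (Intₚ.pos-+ M (a Nat.^ p)) ⟩
    + 1 + (+ M + + (a Nat.^ p))      ≈⟨ +-cong (≋-refl {+ 1}) (+-cong M≋0 aᵖ≋a) ⟩
    + 1 + (+ 0 + + a)                ≡⟨ cong (λ x → + 1 + x) (Intₚ.+-identityˡ (+ a)) ⟩
    + 1 + + a                        ≡⟨ Intₚ.pos-+ 1 a ⟨
    + suc a                          ∎
    where
    M≋0 : + M ≋ + 0
    M≋0 = ∣⇒≋0 (ℤ∣.∣ᵤ⇒∣ p∣M)
    aᵖ≋a : + (a Nat.^ p) ≋ + a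
    aᵖ≋a = ≋-trans (≡⇒≋ (+-^ a p)) (fermat-ℕ a)

  fermat : ∀ a → a ^ p ≋ a
  fermat a = begin
    a ^ p                ≈⟨ ^-cong p (≋residue a) ⟩
    (+ residue a) ^ p    ≈⟨ fermat-ℕ (residue a) ⟩
    + residue a          ≈⟨ ≋residue a ⟨
    a                    ∎

  fermat-little : ∀ a → a ≉ + 0 → a ^ (p Nat.∸ 1) ≋ + 1
  fermat-little a a≉0 = cancelˡ prime a≉0 (begin
    a * a ^ (p Nat.∸ 1)  ≡⟨ cong (a ^_) p≡1+[p-1] ⟨
    a ^ p                ≈⟨ fermat a ⟩
    a                    ≡⟨ Intₚ.*-identityʳ a ⟨
    a * + 1              ∎)

  _⁻¹ : ℤ → ℤ
  a ⁻¹ = a ^ (p Nat.∸ 2)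

  ⁻¹-inverseʳ : ∀ {a} → a ≉ + 0 → a * a ⁻¹ ≋ + 1
  ⁻¹-inverseʳ {a} a≉0 = ≋-trans (≡⇒≋ (cong (a ^_) p-1≡1+[p-2])) (fermat-little a a≉0)
    where
    p-1≡1+[p-2] : suc (p Nat.∸ 2) ≡ p Nat.∸ 1
    p-1≡1+[p-2] = sym (ℕₚ.+-∸-assoc 1 (PrimeFacts.1<p p prime))

module Lagrange (p : ℕ) (prime : Prime p) where

  open Int using (+_; _+_; _*_; _-_; -_; _^_)
  open Congruence p
  open import Data.List.Base using (List; []; _∷_; length; take)
  import Data.List.Properties as Listₚ
  open import Data.List.Relation.Unary.All as All using (All; []; _∷_)
  import Data.List.Relation.Unary.All.Properties as Allₚ
  open import Data.List.Relation.Unary.AllPairs using (AllPairs; []; _∷_)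
  import Data.List.Relation.Unary.AllPairs.Properties as AllPairsₚ

  -- Polynomials as coefficient lists, constant term first.
  Poly : Set
  Poly = List ℤ

  ⟦_⟧ : Poly → ℤ → ℤ
  ⟦ []     ⟧ x = + 0
  ⟦ c ∷ cs ⟧ x = c + x * ⟦ cs ⟧ x

  infixl 6 _⊕_
  _⊕_ : Poly → Poly → Poly
  []       ⊕ gs       = gs
  (f ∷ fs) ⊕ []       = f ∷ fs
  (f ∷ fs) ⊕ (g ∷ gs) = f + g ∷ fs ⊕ gs

  scale : ℤ → Poly → Poly
  scale r []       = []
  scale r (c ∷ cs) = r * c ∷ scale r cs

  ⟦⊕⟧ : ∀ fs gs x → ⟦ fs ⊕ gs ⟧ x ≡ ⟦ fs ⟧ x + ⟦ gs ⟧ x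
  ⟦⊕⟧ []       gs       x = sym (Intₚ.+-identityˡ (⟦ gs ⟧ x))
  ⟦⊕⟧ (f ∷ fs) []       x = sym (Intₚ.+-identityʳ (⟦ f ∷ fs ⟧ x))
  ⟦⊕⟧ (f ∷ fs) (g ∷ gs) x = trans (cong (λ t → f + g + x * t) (⟦⊕⟧ fs gs x))
                                  (interchange f g x (⟦ fs ⟧ x) (⟦ gs ⟧ x))
    where interchange : ∀ f g x F G → f + g + x * (F + G) ≡ (f + x * F) + (g + x * G)
          interchange = solve-∀

  ⟦scale⟧ : ∀ r cs x → ⟦ scale r cs ⟧ x ≡ r * ⟦ cs ⟧ x
  ⟦scale⟧ r []       x = sym (Intₚ.*-zeroʳ r)
  ⟦scale⟧ r (c ∷ cs) x = trans (cong (λ t → r * c + x * t) (⟦scale⟧ r cs x))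
                               (factor r c x (⟦ cs ⟧ x))
    where factor : ∀ r c x C → r * c + x * (r * C) ≡ r * (c + x * C)
          factor = solve-∀

  length-⊕ : ∀ {n} fs gs → length fs Nat.≤ n → length gs Nat.≤ n → length (fs ⊕ gs) Nat.≤ n
  length-⊕ []       gs       _ gs≤n = gs≤n
  length-⊕ (f ∷ fs) []       fs≤n _ = fs≤n
  length-⊕ (f ∷ fs) (g ∷ gs) (s≤s fs≤n) (s≤s gs≤n) = s≤s (length-⊕ fs gs fs≤n gs≤n)

  length-scale : ∀ r cs → length (scale r cs) ≡ length cs
  length-scale r []       = refl
  length-scale r (c ∷ cs) = cong suc (length-scale r cs)

  -- Synthetic division by x - r: the quotient has one coefficient fewer.
  quotient : Poly → ℤ → Poly
  quotient []       r = []
  quotient (c ∷ cs) r = cs ⊕ scale r (quotient cs r)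

  factor-theorem : ∀ cs r x → ⟦ cs ⟧ x - ⟦ cs ⟧ r ≡ (x - r) * ⟦ quotient cs r ⟧ x
  factor-theorem []       r x = zero-case x r
    where zero-case : ∀ x r → + 0 - + 0 ≡ (x - r) * + 0
          zero-case = solve-∀
  factor-theorem (c ∷ cs) r x = begin
    (c + x * F) - (c + r * ⟦ cs ⟧ r)       ≡⟨ split c x r F (⟦ cs ⟧ r) ⟩
    (x - r) * F + r * (F - ⟦ cs ⟧ r)       ≡⟨ cong (λ t → (x - r) * F + r * t) (factor-theorem cs r x) ⟩
    (x - r) * F + r * ((x - r) * Q)        ≡⟨ collect x r F Q ⟩
    (x - r) * (F + r * Q)                  ≡⟨ cong (λ t → (x - r) * (F + t)) (⟦scale⟧ r (quotient cs r) x) ⟨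
    (x - r) * (F + ⟦ scale r (quotient cs r) ⟧ x) ≡⟨ cong ((x - r) *_) (⟦⊕⟧ cs (scale r (quotient cs r)) x) ⟨
    (x - r) * ⟦ quotient (c ∷ cs) r ⟧ x   ∎
    where
    open ≡-Reasoning
    F = ⟦ cs ⟧ x
    Q = ⟦ quotient cs r ⟧ x
    split : ∀ c x r F G → (c + x * F) - (c + r * G) ≡ (x - r) * F + r * (F - G)
    split = solve-∀
    collect : ∀ x r F Q → (x - r) * F + r * ((x - r) * Q) ≡ (x - r) * (F + r * Q)
    collect = solve-∀

  length-quotient : ∀ cs r → length (quotient cs r) Nat.≤ Nat.pred (length cs)
  length-quotient []       r = z≤n
  length-quotient (c ∷ cs) r = length-⊕ cs (scale r (quotient cs r)) ℕₚ.≤-refl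
    (subst (Nat._≤ length cs) (sym (length-scale r (quotient cs r)))
      (ℕₚ.≤-trans (length-quotient cs r) ℕₚ.pred[n]≤n))

  -- A polynomial with no more coefficients than it has pairwise
  -- incongruent roots vanishes everywhere: divide by x - r for the first
  -- root r; the quotient vanishes at the remaining roots by Euclid's lemma.
  vanishes : ∀ rs → AllPairs _≉_ rs → ∀ cs → length cs Nat.≤ length rs →
             All (λ r → ⟦ cs ⟧ r ≋ + 0) rs → ∀ x → ⟦ cs ⟧ x ≋ + 0
  vanishes []       _                    []  _   _                    x = ≋-refl
  vanishes (r ∷ rs) (r≉rs ∷ rs-distinct) cs len (cs[r]≋0 ∷ cs[rs]≋0) x = begin
    ⟦ cs ⟧ x                          ≡⟨ split (⟦ cs ⟧ x) (⟦ cs ⟧ r) ⟩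
    (⟦ cs ⟧ x - ⟦ cs ⟧ r) + ⟦ cs ⟧ r  ≡⟨ cong (_+ ⟦ cs ⟧ r) (factor-theorem cs r x) ⟩
    (x - r) * ⟦ q ⟧ x + ⟦ cs ⟧ r      ≈⟨ +-cong (*-cong (≋-refl {x - r}) q[x]≋0) cs[r]≋0 ⟩
    (x - r) * + 0 + + 0               ≡⟨ cong (_+ + 0) (Intₚ.*-zeroʳ (x - r)) ⟩
    + 0                               ∎
    where
    open import Relation.Binary.Reasoning.Setoid setoid
    split : ∀ a b → a ≡ (a - b) + b
    split = solve-∀
    q = quotient cs r
    q-short : length q Nat.≤ length rs
    q-short = ℕₚ.≤-trans (length-quotient cs r) (ℕₚ.pred-mono-≤ len)
    -- At another root r', (r' - r) · q(r') ≋ cs(r') - cs(r) ≋ 0 and r' ≉ r.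
    q-root : ∀ {r'} → r ≉ r' → ⟦ cs ⟧ r' ≋ + 0 → ⟦ q ⟧ r' ≋ + 0
    q-root {r'} r≉r' cs[r']≋0 with euclid prime (begin
      (r' - r) * ⟦ q ⟧ r'        ≡⟨ factor-theorem cs r r' ⟨
      ⟦ cs ⟧ r' - ⟦ cs ⟧ r       ≈⟨ -‿cong cs[r']≋0 cs[r]≋0 ⟩
      + 0 - + 0                  ≡⟨⟩
      + 0                        ∎)
    ... | inj₁ r'-r≋0 = ⊥-elim (r≉r' (≋-sym (-≋0⇒≋ r'-r≋0)))
    ... | inj₂ q[r']≋0 = q[r']≋0
    q[x]≋0 = vanishes rs rs-distinct q q-short (All.zipWith (λ (a , b) → q-root a b) (r≉rs , cs[rs]≋0)) x

  monomial : ℕ → Poly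
  monomial zero    = + 1 ∷ []
  monomial (suc n) = + 0 ∷ monomial n

  ⟦monomial⟧ : ∀ n x → ⟦ monomial n ⟧ x ≡ x ^ n
  ⟦monomial⟧ zero    x = trans (cong (λ t → + 1 + t) (Intₚ.*-zeroʳ x)) refl
  ⟦monomial⟧ (suc n) x = trans (Intₚ.+-identityˡ _) (cong (x *_) (⟦monomial⟧ n x))

  length-monomial : ∀ n → length (monomial n) ≡ suc n
  length-monomial zero    = refl
  length-monomial (suc n) = cong suc (length-monomial n)

  unity : ℕ → Poly
  unity m = - + 1 ∷ monomial m

  ⟦unity⟧ : ∀ m x → ⟦ unity m ⟧ x ≡ x ^ suc m - + 1
  ⟦unity⟧ m x = trans (cong (λ t → - + 1 + x * t) (⟦monomial⟧ m x)) (swap (x * x ^ m))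
    where swap : ∀ a → - + 1 + a ≡ a - + 1
          swap = solve-∀

  -- xⁿ ≡ 1 (n > 0) has at most n pairwise incongruent solutions: otherwise
  -- xⁿ - 1 would vanish at 0, i.e. -1 ≡ 0.
  roots-of-unity : ∀ n → 0 Nat.< n → ∀ rs → AllPairs _≉_ rs → All (λ r → r ^ n ≋ + 1) rs →
                   length rs Nat.≤ n
  roots-of-unity (suc m) _ rs distinct roots with length rs ℕₚ.≤? suc m
  ... | yes short = short
  ... | no  long  = ⊥-elim (1≉0 prime (neg-cong (begin
    - + 1                   ≡⟨ cong (_- + 1) (Intₚ.*-zeroˡ ((+ 0) ^ m)) ⟨
    (+ 0) ^ suc m - + 1     ≡⟨ ⟦unity⟧ m (+ 0) ⟨
    ⟦ unity m ⟧ (+ 0)       ≈⟨ vanishes rs' (AllPairsₚ.take⁺ (suc (suc m)) distinct) (unity m) enough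
                                 (Allₚ.take⁺ (suc (suc m)) (All.map (λ {r} → root⇒zero {r}) roots)) (+ 0) ⟩
    + 0                     ∎)))
    where
    open import Relation.Binary.Reasoning.Setoid setoid
    rs' = take (suc (suc m)) rs
    enough : length (unity m) Nat.≤ length rs'
    enough = subst (Nat._≤ length rs')
               (cong suc (sym (length-monomial m)))
               (ℕₚ.≤-reflexive (sym (trans (Listₚ.length-take (suc (suc m)) rs)
                                           (ℕₚ.m≤n⇒m⊓n≡m (ℕₚ.≰⇒> long)))))
    root⇒zero : ∀ {r} → r ^ suc m ≋ + 1 → ⟦ unity m ⟧ r ≋ + 0
    root⇒zero {r} rᵐ≋1 = ≋-trans (≡⇒≋ (⟦unity⟧ m r)) (-‿cong rᵐ≋1 (≋-refl {+ 1}))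

module RadiusPrimeArithmetic
  (p : ℕ) (prime : Prime p) (k t : ℕ) (0<k : 0 Nat.< k) (0<t : 0 Nat.< t)
  (p-1≡2kt : p Nat.∸ 1 ≡ 2 Nat.* (k Nat.* t))
  (distinct-powers : ∀ a b → 1 Nat.≤ a → a Nat.≤ k → 1 Nat.≤ b → b Nat.≤ k → a ≢ b →
                       Congruence._≉_ p ((Int.+ a) Int.^ (2 Nat.* t)) ((Int.+ b) Int.^ (2 Nat.* t)))
  where

  open Nat using (_≤_; _<_)
  open Int using (+_; _+_; _*_; _-_; -_; _^_)
  open Congruence p
  open PrimeFacts p prime using (p≢0)
  open Fermat p prime using (fermat-little; _⁻¹; ⁻¹-inverseʳ)
  open Lagrange p prime using (roots-of-unity)
  open Powers
  open import Data.List.Base using (List; []; _∷_; length; map; _++_; applyUpTo; filter)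
  import Data.List.Properties as Listₚ
  open import Data.List.Relation.Unary.All as All using (All; []; _∷_)
  import Data.List.Relation.Unary.All.Properties as Allₚ
  open import Data.List.Relation.Unary.AllPairs as AllPairs using (AllPairs; []; _∷_)
  import Data.List.Relation.Unary.AllPairs.Properties as AllPairsₚ
  import Data.List.Membership.Propositional.Properties as ∈ₚ
  open import Data.Fin.Base using (Fin; toℕ; fromℕ<)
  import Data.Fin.Properties as Finₚ

  e h : ℕ
  e = 2 Nat.* t
  h = k Nat.* t

  p≡1+h+h : p ≡ suc (h Nat.+ h)
  p≡1+h+h = trans (PrimeFacts.p≡1+[p-1] p prime)
                  (cong suc (trans p-1≡2kt (cong (h Nat.+_) (ℕₚ.+-identityʳ h))))

  h<p : h < p
  h<p = subst (h <_) (sym p≡1+h+h) (s≤s (ℕₚ.m≤m+n h h))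

  k<p : k < p
  k<p = ℕₚ.≤-<-trans (subst (_≤ h) (ℕₚ.*-identityʳ k) (ℕₚ.*-monoʳ-≤ k 0<t)) h<p

  0<e : 0 < e
  0<e = ℕₚ.*-monoʳ-< 2 0<t

  -- For δ ≢ 0, δ^e is a k-th root of unity, since e k = p - 1.
  kth-root : ∀ {δ} → δ ≉ + 0 → (δ ^ e) ^ k ≋ + 1
  kth-root {δ} δ≉0 = ≋-trans (≡⇒≋ (trans (Intₚ.^-*-assoc δ e k) (cong (δ ^_) ek≡p-1)))
                             (fermat-little δ δ≉0)
    where
    ek≡p-1 : e Nat.* k ≡ p Nat.∸ 1
    ek≡p-1 = trans (ℕₚ.*-assoc 2 t k) (trans (cong (2 Nat.*_) (ℕₚ.*-comm t k)) (sym p-1≡2kt))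

  -- The k pairwise incongruent k-th roots of unity 1^e, …, k^e are all of
  -- them (Lagrange), so δ^e is one of them.
  small-power : ∀ {δ} → δ ≉ + 0 → ∃[ i ] (1 ≤ i × i ≤ k × δ ^ e ≋ (+ i) ^ e)
  small-power {δ} δ≉0 with Finₚ.any? (λ (i : Fin k) → δ ^ e ≋? (+ suc (toℕ i)) ^ e)
  ... | yes (i , δᵉ≋iᵉ) = suc (toℕ i) , s≤s z≤n , Finₚ.toℕ<n i , δᵉ≋iᵉ
  ... | no  none = ⊥-elim (ℕₚ.<-irrefl (Listₚ.length-applyUpTo _ k)
          (roots-of-unity k 0<k (δ ^ e ∷ powers) all-distinct all-roots))
    where
    powers = applyUpTo (λ j → (+ suc j) ^ e) k
    all-distinct : AllPairs _≉_ (δ ^ e ∷ powers)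
    all-distinct =
      Allₚ.applyUpTo⁺₁ _ k (λ {j} j<k δᵉ≋ → none (fromℕ< j<k ,
        subst (λ n → δ ^ e ≋ (+ suc n) ^ e) (sym (Finₚ.toℕ-fromℕ< j<k)) δᵉ≋))
      ∷ AllPairsₚ.applyUpTo⁺₁ _ k (λ {i} {j} i<j j<k →
          distinct-powers (suc i) (suc j) (s≤s z≤n) (ℕₚ.<-trans i<j j<k) (s≤s z≤n) j<k
            (λ i≡j → ℕₚ.<⇒≢ i<j (ℕₚ.suc-injective i≡j)))
    all-roots : All (λ r → r ^ k ≋ + 1) (δ ^ e ∷ powers)
    all-roots = kth-root δ≉0 ∷ Allₚ.applyUpTo⁺₁ _ k (λ {j} j<k →
                  kth-root (positive≉0 (s≤s z≤n) (ℕₚ.≤-<-trans j<k k<p)))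

  -- The e-th roots of unity among 1, …, h.  As e is even and 1 + h + h = p,
  -- they contain exactly one of u, -u for each e-th root of unity u.
  IsRoot : ℕ → Set
  IsRoot x = (+ x) ^ e ≋ + 1

  half-roots : List ℕ
  half-roots = filter (λ x → (+ x) ^ e ≋? + 1) (applyUpTo suc h)

  InRange : ℕ → Set
  InRange x = 1 ≤ x × x ≤ h

  half-roots-in-range : All InRange half-roots
  half-roots-in-range = Allₚ.filter⁺ _ (Allₚ.applyUpTo⁺₁ suc h (λ i<h → s≤s z≤n , i<h))

  half-roots-increasing : AllPairs (λ a b → a < b × b ≤ h) half-roots
  half-roots-increasing = AllPairsₚ.filter⁺ _ (AllPairsₚ.applyUpTo⁺₁ suc h (λ i<j j<h → s≤s i<j , j<h))

  half-roots-are-roots : All IsRoot half-roots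
  half-roots-are-roots = Allₚ.all-filter _ (applyUpTo suc h)

  ∈-half-roots : ∀ {w} → InRange w → IsRoot w → w ∈ half-roots
  ∈-half-roots {suc w} (_ , w<h) root = ∈ₚ.∈-filter⁺ _ (∈ₚ.∈-applyUpTo⁺ suc w<h) root

  -- The 2 |half-roots| residues ±d, d ∈ half-roots, are incongruent e-th
  -- roots of unity, so there are at most e = 2t of them (Lagrange).
  |half-roots|≤t : length half-roots ≤ t
  |half-roots|≤t = ℕₚ.*-cancelˡ-≤ 2 (subst (_≤ e) length-±roots
                     (roots-of-unity e 0<e ±roots ±roots-distinct ±roots-roots))
    where
    ±roots = map +_ half-roots ++ map (λ x → - + x) half-roots
    length-±roots : length ±roots ≡ 2 Nat.* length half-roots
    length-±roots = begin
      length ±roots                     ≡⟨ Listₚ.length-++ (map +_ half-roots) ⟩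
      length (map +_ half-roots) Nat.+ length (map _ half-roots)
                                        ≡⟨ cong₂ Nat._+_ (Listₚ.length-map +_ half-roots) (Listₚ.length-map _ half-roots) ⟩
      |T| Nat.+ |T|                     ≡⟨ cong (|T| Nat.+_) (ℕₚ.+-identityʳ |T|) ⟨
      2 Nat.* |T|                       ∎
      where open ≡-Reasoning
            |T| = length half-roots
    incongruent : ∀ {a b} → a < b × b ≤ h → + a ≉ + b
    incongruent (a<b , b≤h) a≋b =
      ℕₚ.<⇒≢ a<b (canonical (ℕₚ.<-trans a<b (ℕₚ.≤-<-trans b≤h h<p)) (ℕₚ.≤-<-trans b≤h h<p) a≋b)
    -- a ≋ -b would make 0 < a + b ≤ 2h < p a multiple of p
    not-opposite : ∀ {a b} → InRange a → InRange b → + a ≉ - + b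
    not-opposite {a} {b} (1≤a , a≤h) (_ , b≤h) a≋-b = positive≉0
      (ℕₚ.<-≤-trans 1≤a (ℕₚ.m≤m+n a b))
      (subst (a Nat.+ b <_) (sym p≡1+h+h) (s≤s (ℕₚ.+-mono-≤ a≤h b≤h)))
      (≋-trans (≡⇒≋ (Intₚ.pos-+ a b))
        (≋-trans (+-cong a≋-b (≋-refl {+ b})) (≡⇒≋ (Intₚ.+-inverseˡ (+ b)))))
    ±roots-distinct : AllPairs _≉_ ±roots
    ±roots-distinct = AllPairsₚ.++⁺
      (AllPairsₚ.map⁺ (AllPairs.map incongruent half-roots-increasing))
      (AllPairsₚ.map⁺ (AllPairs.map (λ ab -a≋-b → incongruent ab
         (subst₂ _≋_ (Intₚ.neg-involutive _) (Intₚ.neg-involutive _) (neg-cong -a≋-b))) half-roots-increasing))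
      (Allₚ.map⁺ (All.map (λ a-in → Allₚ.map⁺ (All.map (not-opposite a-in) half-roots-in-range)) half-roots-in-range))
    ±roots-roots : All (λ r → r ^ e ≋ + 1) ±roots
    ±roots-roots = Allₚ.++⁺ (Allₚ.map⁺ half-roots-are-roots)
      (Allₚ.map⁺ (All.map (λ {x} root → ≋-trans (≡⇒≋ (^-neg-even (+ x) t)) root) half-roots-are-roots))

  -- A nonzero e-th root of unity u is ±d for some d ∈ half-roots: d is the
  -- residue w of u if w ≤ h, and p - w ≋ -u otherwise.
  ±half-root : ∀ {u} → u ≉ + 0 → u ^ e ≋ + 1 → ∃[ d ] (d ∈ half-roots × (u ≋ + d ⊎ u ≋ - + d))
  ±half-root {u} u≉0 uᵉ≋1 with residue u ℕₚ.≤? h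
  ... | yes w≤h = w , ∈-half-roots (1≤w , w≤h) w-root , inj₁ u≋w
    where
    w = residue u
    u≋w = ≋residue u
    1≤w : 1 ≤ w
    1≤w = ℕₚ.n≢0⇒n>0 λ w≡0 → u≉0 (≋-trans u≋w (≡⇒≋ (cong +_ w≡0)))
    w-root = ≋-trans (^-cong e (≋-sym u≋w)) uᵉ≋1
  ... | no  w≰h = p Nat.∸ w , ∈-half-roots (1≤p-w , p-w≤h) p-w-root , inj₂ u≋-[p-w]
    where
    open import Relation.Binary.Reasoning.Setoid setoid
    w = residue u
    w<p = residue<p u
    p-w≋-w : + (p Nat.∸ w) ≋ - + w
    p-w≋-w = begin
      + (p Nat.∸ w)                      ≡⟨ cancel (+ (p Nat.∸ w)) (+ w) ⟩
      (+ (p Nat.∸ w) + + w) - + w        ≡⟨ cong (_- + w) (Intₚ.pos-+ (p Nat.∸ w) w) ⟨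
      + (p Nat.∸ w Nat.+ w) - + w        ≡⟨ cong (λ n → + n - + w) (ℕₚ.m∸n+n≡m (ℕₚ.<⇒≤ w<p)) ⟩
      + p - + w                          ≈⟨ -‿cong p≋0 (≋-refl {+ w}) ⟩
      + 0 - + w                          ≡⟨ Intₚ.+-identityˡ (- + w) ⟩
      - + w                              ∎
      where cancel : ∀ a b → a ≡ (a + b) - b
            cancel = solve-∀
    u≋-[p-w] : u ≋ - + (p Nat.∸ w)
    u≋-[p-w] = ≋-trans (≋residue u)
                 (≋-trans (≡⇒≋ (sym (Intₚ.neg-involutive (+ w)))) (neg-cong (≋-sym p-w≋-w)))
    1≤p-w = ℕₚ.m<n⇒0<n∸m w<p
    p-w≤h : p Nat.∸ w ≤ h
    p-w≤h = ℕₚ.≤-trans (ℕₚ.∸-monoʳ-≤ p (ℕₚ.≰⇒> w≰h))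
              (ℕₚ.≤-reflexive (trans (cong (Nat._∸ suc h) p≡1+h+h) (ℕₚ.m+n∸m≡n h h)))
    p-w-root : IsRoot (p Nat.∸ w)
    p-w-root = ≋-trans (^-cong e p-w≋-w)
                 (≋-trans (≡⇒≋ (^-neg-even (+ w) t)) (≋-trans (^-cong e (≋-sym (≋residue u))) uᵉ≋1))


  divide-by : ∀ {δ} i → + i ≉ + 0 → δ ≉ + 0 → δ ^ e ≋ (+ i) ^ e →
              ∃[ u ] (u ≉ + 0 × u ^ e ≋ + 1 × δ ≋ + i * u)
  divide-by {δ} i I≉0 δ≉0 δᵉ≋iᵉ = u , u≉0 , uᵉ≋1 , δ≋I·u
    where
    open import Relation.Binary.Reasoning.Setoid setoid
    I = + i
    u = δ * I ⁻¹
    δ≋I·u : δ ≋ I * u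
    δ≋I·u = begin
      δ                    ≡⟨ Intₚ.*-identityʳ δ ⟨
      δ * + 1              ≈⟨ *-cong (≋-refl {δ}) (⁻¹-inverseʳ I≉0) ⟨
      δ * (I * I ⁻¹)       ≡⟨ rearrange δ I (I ⁻¹) ⟩
      I * u                ∎
      where rearrange : ∀ a b c → a * (b * c) ≡ b * (a * c)
            rearrange = solve-∀
    u≉0 : u ≉ + 0
    u≉0 u≋0 = δ≉0 (≋-trans δ≋I·u (≋-trans (*-cong (≋-refl {I}) u≋0) (≡⇒≋ (Intₚ.*-zeroʳ I))))
    uᵉ≋1 : u ^ e ≋ + 1
    uᵉ≋1 = begin
      (δ * I ⁻¹) ^ e       ≡⟨ ^-distrib-* δ (I ⁻¹) e ⟩
      δ ^ e * (I ⁻¹) ^ e   ≈⟨ *-cong δᵉ≋iᵉ (≋-refl {(I ⁻¹) ^ e}) ⟩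
      I ^ e * (I ⁻¹) ^ e   ≡⟨ ^-distrib-* I (I ⁻¹) e ⟨
      (I * I ⁻¹) ^ e       ≈⟨ ^-cong e (⁻¹-inverseʳ I≉0) ⟩
      (+ 1) ^ e            ≡⟨ Intₚ.^-zeroˡ e ⟩
      + 1                  ∎

  Decomposition : ℤ → Set
  Decomposition δ = ∃[ i ] ∃[ d ] (1 ≤ i × i ≤ k × d ∈ half-roots × (δ ≋ + i * + d ⊎ - δ ≋ + i * + d))

  decompose : ∀ {δ} → δ ≉ + 0 → Decomposition δ
  decompose {δ} δ≉0 =
    let i , 1≤i , i≤k , δᵉ≋iᵉ = small-power δ≉0
        u , u≉0 , uᵉ≋1 , δ≋i·u = divide-by i (positive≉0 1≤i (ℕₚ.≤-<-trans i≤k k<p)) δ≉0 δᵉ≋iᵉ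
        d , d∈ , u≋±d = ±half-root u≉0 uᵉ≋1
    in i , d , 1≤i , i≤k , d∈ , Sum.map (plus i δ≋i·u) (minus i δ≋i·u) u≋±d
    where
    plus : ∀ i {u z} → δ ≋ + i * u → u ≋ z → δ ≋ + i * z
    plus i δ≋i·u u≋z = ≋-trans δ≋i·u (*-cong (≋-refl {+ i}) u≋z)
    minus : ∀ i {u d} → δ ≋ + i * u → u ≋ - + d → - δ ≋ + i * + d
    minus i {d = d} δ≋i·u u≋-d = ≋-trans (neg-cong (plus i δ≋i·u u≋-d))
      (≡⇒≋ (trans (Intₚ.neg-distribʳ-* (+ i) (- + d)) (cong (λ x → + i * x) (Intₚ.neg-involutive (+ d)))))

module Adjacency where

  open import Data.List.Base using (List; length; lookup; applyUpTo)
  import Data.List.Properties as Listₚ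
  open import Data.Fin.Base using (Fin; toℕ; fromℕ<)
  import Data.Fin.Properties as Finₚ

  Adjacent : ∀ {A : Set} → ℕ → List A → A → A → Set
  Adjacent k s x y =
    ∃[ i ] ∃[ j ] (lookup s i ≡ x × lookup s j ≡ y × Nat.∣ toℕ i - toℕ j ∣ Nat.≤ k)

  Adjacent-sym : ∀ {A : Set} {k s} {x y : A} → Adjacent k s x y → Adjacent k s y x
  Adjacent-sym (i , j , sᵢ≡x , sⱼ≡y , ∣i-j∣≤k) =
    j , i , sⱼ≡y , sᵢ≡x , subst (Nat._≤ _) (ℕₚ.∣-∣-comm (toℕ i) (toℕ j)) ∣i-j∣≤k

  adjacent-applyUpTo : ∀ {A : Set} {k} (f : ℕ → A) L {x y} u v → u Nat.< L → v Nat.< L →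
                       f u ≡ x → f v ≡ y → Nat.∣ u - v ∣ Nat.≤ k → Adjacent k (applyUpTo f L) x y
  adjacent-applyUpTo {k = k} f L u v u<L v<L fu≡x fv≡y ∣u-v∣≤k =
    position u<L , position v<L , entry u<L fu≡x , entry v<L fv≡y ,
    subst (Nat._≤ k) (sym (cong₂ Nat.∣_-_∣ (toℕ-position u<L) (toℕ-position v<L))) ∣u-v∣≤k
    where
    position : ∀ {w} → w Nat.< L → Fin (length (applyUpTo f L))
    position w<L = fromℕ< (subst (_ Nat.<_) (sym (Listₚ.length-applyUpTo f L)) w<L)
    toℕ-position : ∀ {w} (w<L : w Nat.< L) → toℕ (position w<L) ≡ w
    toℕ-position w<L = Finₚ.toℕ-fromℕ< _
    entry : ∀ {w z} (w<L : w Nat.< L) → f w ≡ z → lookup (applyUpTo f L) (position w<L) ≡ z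
    entry w<L fw≡z = trans (Listₚ.lookup-applyUpTo f L _) (trans (cong f (toℕ-position w<L)) fw≡z)

-- Given nonzero residues d 0, d 1, … modulo p, the
-- sequence consists of N arithmetic progressions of p + k terms with
-- common differences d 0, …, d (N-1), each starting where the previous
-- one ended: block j occupies positions jB, …, jB + B (B = p - 1 + k)
-- with values (origin j + l)·d j, and origin (j+1) is chosen so that
-- origin (j+1)·d (j+1) ≋ (origin j + B)·d j.  Since each block runs
-- through all residues and then k further steps, it has every x next to
-- x + i·d j, i ≤ k, within distance k.
module ChainedProgressions
  (p : ℕ) (prime : Prime p) (k : ℕ) (0<k : 0 Nat.< k)
  (d : ℕ → ℤ) (d≉0 : ∀ j → Congruence._≉_ p (d j) (Int.+ 0))
  where

  open Nat using (_≤_; _<_; _/_; _%_)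
  open Int using (+_; _+_; _*_; _-_; -_)
  open Congruence p
  open PrimeFacts p prime using (p≡1+[p-1]; p≢0)
  open Fermat p prime using (_⁻¹; ⁻¹-inverseʳ)
  open Adjacency
  open import Data.List.Base using (List; applyUpTo)
  open import Data.Fin.Base using (Fin; toℕ; fromℕ<)
  import Data.Fin.Properties as Finₚ

  B : ℕ
  B = p Nat.∸ 1 Nat.+ k

  instance
    B≢0 : Nat.NonZero B
    B≢0 = Nat.>-nonZero (ℕₚ.<-≤-trans 0<k (ℕₚ.m≤n+m k (p Nat.∸ 1)))

  origin : ℕ → ℕ
  origin zero    = 0
  origin (suc j) = residue ((+ origin j + + B) * d j * d (suc j) ⁻¹)

  glue : ∀ j → (+ origin (suc j) + + 0) * d (suc j) ≋ (+ origin j + + B) * d j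
  glue j = begin
    (+ origin (suc j) + + 0) * d (suc j)  ≡⟨ cong (_* d (suc j)) (Intₚ.+-identityʳ (+ origin (suc j))) ⟩
    + origin (suc j) * d (suc j)          ≈⟨ *-cong (≋-sym (≋residue (e * d (suc j) ⁻¹))) (≋-refl {d (suc j)}) ⟩
    e * d (suc j) ⁻¹ * d (suc j)         ≡⟨ rearrange e (d (suc j) ⁻¹) (d (suc j)) ⟩
    e * (d (suc j) * d (suc j) ⁻¹)       ≈⟨ *-cong (≋-refl {e}) (⁻¹-inverseʳ (d≉0 (suc j))) ⟩
    e * + 1                              ≡⟨ Intₚ.*-identityʳ e ⟩
    e                                    ∎
    where
    open import Relation.Binary.Reasoning.Setoid setoid
    e = (+ origin j + + B) * d j
    rearrange : ∀ a b c → a * b * c ≡ a * (c * b)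
    rearrange = solve-∀

  term : ℕ → ℤ
  term n = (+ origin (n / B) + + (n % B)) * d (n / B)

  term-in-block : ∀ j l → l ≤ B → term (j Nat.* B Nat.+ l) ≋ (+ origin j + + l) * d j
  term-in-block j l l≤B with l ℕₚ.<? B
  ... | yes l<B = ≡⇒≋ (cong₂ (λ b o → (+ origin b + + o) * d b) block offset)
    where
    block : (j Nat.* B Nat.+ l) / B ≡ j
    block = trans (cong (_/ B) (ℕₚ.+-comm (j Nat.* B) l))
           (trans (NatDM.+-distrib-/-∣ʳ l (ℕ∣.n∣m*n j))
           (cong₂ Nat._+_ (NatDM.m<n⇒m/n≡0 l<B) (NatDM.m*n/n≡m j B)))
    offset : (j Nat.* B Nat.+ l) % B ≡ l
    offset = trans (cong (_% B) (ℕₚ.+-comm (j Nat.* B) l))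
            (trans (NatDM.[m+kn]%n≡m%n l j B) (NatDM.m<n⇒m%n≡m l<B))
  ... | no  l≮B rewrite ℕₚ.≤-antisym l≤B (ℕₚ.≮⇒≥ l≮B) = begin
    term (j Nat.* B Nat.+ B)               ≡⟨ cong term (ℕₚ.+-comm (j Nat.* B) B) ⟩
    term (suc j Nat.* B)                   ≡⟨ cong₂ (λ b o → (+ origin b + + o) * d b)
                                                (NatDM.m*n/n≡m (suc j) B) (NatDM.m*n%n≡0 (suc j) B) ⟩
    (+ origin (suc j) + + 0) * d (suc j)   ≈⟨ glue j ⟩
    (+ origin j + + B) * d j               ∎
    where open import Relation.Binary.Reasoning.Setoid setoid

  entry : ℕ → Fin p
  entry n = fromℕ< (residue<p (term n))

  entry≡ : ∀ {n} x → term n ≋ + toℕ x → entry n ≡ x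
  entry≡ {n} x term≋x = Finₚ.toℕ-injective (trans (Finₚ.toℕ-fromℕ< _)
    (canonical (residue<p (term n)) (Finₚ.toℕ<n x) (≋-trans (≋-sym (≋residue (term n))) term≋x)))

  sequence : ℕ → List (Fin p)
  sequence N = applyUpTo entry (N Nat.* B Nat.+ 1)

  -- Within block j < N: if y - x ≋ i·d j with i ≤ k, pick m < p with
  -- (s j + m)·d j ≋ x; then positions jB + m and jB + m + i carry x and y.
  block-covers : ∀ N j → j < N → ∀ (x y : Fin p) i → i ≤ k →
                 + toℕ y - + toℕ x ≋ + i * d j → Adjacent k (sequence N) x y
  block-covers N j j<N x y i i≤k y-x≋i·d =
    adjacent-applyUpTo entry (N Nat.* B Nat.+ 1) u v (in-range m≤B) (in-range m+i≤B)
      (entry≡ x (≋-trans (term-in-block j m m≤B) at-m))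
      (entry≡ y (≋-trans (term-in-block j (m Nat.+ i) m+i≤B) at-m+i))
      (subst (_≤ k) (sym (trans (ℕₚ.∣m+n-m+o∣≡∣n-o∣ (j Nat.* B) m (m Nat.+ i))
                                (ℕₚ.∣m-m+n∣≡n m i))) i≤k)
    where
    X = + toℕ x
    s = + origin j
    m = residue (X * d j ⁻¹ - s)
    u = j Nat.* B Nat.+ m
    v = j Nat.* B Nat.+ (m Nat.+ i)
    m≤p-1 : m ≤ p Nat.∸ 1
    m≤p-1 = ℕₚ.≤-pred (subst (m <_) p≡1+[p-1] (residue<p (X * d j ⁻¹ - s)))
    m≤B : m ≤ B
    m≤B = ℕₚ.≤-trans m≤p-1 (ℕₚ.m≤m+n (p Nat.∸ 1) k)
    m+i≤B : m Nat.+ i ≤ B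
    m+i≤B = ℕₚ.+-mono-≤ m≤p-1 i≤k
    in-range : ∀ {l} → l ≤ B → j Nat.* B Nat.+ l < N Nat.* B Nat.+ 1
    in-range {l} l≤B = ℕₚ.≤-<-trans block-end (ℕₚ.m<m+n (N Nat.* B) (s≤s z≤n))
      where
      open ℕₚ.≤-Reasoning
      block-end : j Nat.* B Nat.+ l ≤ N Nat.* B
      block-end = begin
        j Nat.* B Nat.+ l   ≤⟨ ℕₚ.+-monoʳ-≤ (j Nat.* B) l≤B ⟩
        j Nat.* B Nat.+ B   ≡⟨ ℕₚ.+-comm (j Nat.* B) B ⟩
        suc j Nat.* B       ≤⟨ ℕₚ.*-monoˡ-≤ B j<N ⟩
        N Nat.* B           ∎
    at-m : (s + + m) * d j ≋ X
    at-m = begin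
      (s + + m) * d j                       ≈⟨ *-cong (+-cong (≋-refl {s}) (≋-sym (≋residue (X * d j ⁻¹ - s))))
                                                      (≋-refl {d j}) ⟩
      (s + (X * d j ⁻¹ - s)) * d j          ≡⟨ rearrange s X (d j ⁻¹) (d j) ⟩
      X * (d j * d j ⁻¹)                    ≈⟨ *-cong (≋-refl {X}) (⁻¹-inverseʳ (d≉0 j)) ⟩
      X * + 1                               ≡⟨ Intₚ.*-identityʳ X ⟩
      X                                     ∎
      where open import Relation.Binary.Reasoning.Setoid setoid
            rearrange : ∀ s X D d → (s + (X * D - s)) * d ≡ X * (d * D)
            rearrange = solve-∀
    at-m+i : (s + + (m Nat.+ i)) * d j ≋ + toℕ y
    at-m+i = begin
      (s + + (m Nat.+ i)) * d j             ≡⟨ cong (λ n → (s + n) * d j) (Intₚ.pos-+ m i) ⟩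
      (s + (+ m + + i)) * d j               ≡⟨ expand s (+ m) (+ i) (d j) ⟩
      (s + + m) * d j + + i * d j           ≈⟨ +-cong at-m (≋-sym y-x≋i·d) ⟩
      X + (+ toℕ y - X)                     ≡⟨ cancel X (+ toℕ y) ⟩
      + toℕ y                               ∎
      where open import Relation.Binary.Reasoning.Setoid setoid
            expand : ∀ s m i d → (s + (m + i)) * d ≡ (s + m) * d + i * d
            expand = solve-∀
            cancel : ∀ a b → a + (b - a) ≡ b
            cancel = solve-∀

module Padded {A : Set} (default : A) where

  open import Data.List.Base using (List; []; _∷_; length)
  open import Data.List.Relation.Unary.All using (All; []; _∷_)
  open import Data.List.Relation.Unary.Any using (here; there)
  open import Data.List.Membership.Propositional using (_∈_)

  lookup-or : List A → ℕ → A
  lookup-or []       _       = default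
  lookup-or (x ∷ xs) zero    = x
  lookup-or (x ∷ xs) (suc j) = lookup-or xs j

  lookup-or-All : ∀ {P : A → Set} {xs} → All P xs → P default → ∀ j → P (lookup-or xs j)
  lookup-or-All []         P-default j       = P-default
  lookup-or-All (Px ∷ _)   _         zero    = Px
  lookup-or-All (_ ∷ Pxs)  P-default (suc j) = lookup-or-All Pxs P-default j

  lookup-or-∈ : ∀ {x xs} → x ∈ xs → ∃[ j ] (j Nat.< length xs × lookup-or xs j ≡ x)
  lookup-or-∈ (here refl) = 0 , s≤s z≤n , refl
  lookup-or-∈ (there x∈xs) with lookup-or-∈ x∈xs
  ... | j , j<n , eq = suc j , s≤s j<n , eq

-- The k-radius sequence for a k-radius prime: t chained progressions whose
-- differences run through half-roots, padded with 1.  Every x ≢ y has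
-- y - x = ±i·d with i ≤ k, d ∈ half-roots, so the block with difference
-- d places x and y within distance k.
module RadiusSequence
  (p : ℕ) (prime : Prime p) (k t : ℕ) (0<k : 0 Nat.< k) (0<t : 0 Nat.< t)
  (p-1≡2kt : p Nat.∸ 1 ≡ 2 Nat.* (k Nat.* t))
  (distinct-powers : ∀ a b → 1 Nat.≤ a → a Nat.≤ k → 1 Nat.≤ b → b Nat.≤ k → a ≢ b →
                       Congruence._≉_ p ((Int.+ a) Int.^ (2 Nat.* t)) ((Int.+ b) Int.^ (2 Nat.* t)))
  where

  open Int using (+_; _+_; _*_; _-_; -_)
  open Congruence p
  open RadiusPrimeArithmetic p prime k t 0<k 0<t p-1≡2kt distinct-powers
  open Padded 1 using (lookup-or; lookup-or-All; lookup-or-∈)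
  open Adjacency
  open import Data.List.Base using (List; length)
  import Data.List.Properties as Listₚ
  open import Data.Fin.Base using (Fin; toℕ)
  import Data.Fin.Properties as Finₚ

  difference : ℕ → ℕ
  difference = lookup-or half-roots

  difference≉0 : ∀ j → + difference j ≉ + 0
  difference≉0 j = positive≉0 (proj₁ in-range) (ℕₚ.≤-<-trans (proj₂ in-range) h<p)
    where
    1≤h = ℕₚ.*-mono-≤ 0<k 0<t
    in-range = lookup-or-All half-roots-in-range (ℕₚ.≤-refl , 1≤h) j

  open ChainedProgressions p prime k 0<k (λ j → + difference j) difference≉0
    public using (B; sequence; block-covers)

  length-sequence : length (sequence t) ≡ t Nat.* B Nat.+ 1
  length-sequence = Listₚ.length-applyUpTo _ _

  covered : ∀ (x y : Fin p) i d → i Nat.≤ k → d ∈ half-roots →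
            + toℕ y - + toℕ x ≋ + i * + d → Adjacent k (sequence t) x y
  covered x y i d i≤k d∈ y-x≋i·d =
    let j , j<|T| , dⱼ≡d = lookup-or-∈ d∈
    in block-covers t j (ℕₚ.<-≤-trans j<|T| |half-roots|≤t) x y i i≤k
         (subst (λ z → + toℕ y - + toℕ x ≋ + i * + z) (sym dⱼ≡d) y-x≋i·d)

  is-radius-sequence : IsRadiusSeq p k (sequence t)
  is-radius-sequence x y x≢y =
    let i , d , _ , i≤k , d∈ , y-x≋±i·d = decompose y-x≉0
    in Sum.[ covered x y i d i≤k d∈
           , (λ x-y≋i·d → Adjacent-sym {s = sequence t}
                (covered y x i d i≤k d∈ (≋-trans (≡⇒≋ (negate (+ toℕ y) (+ toℕ x))) x-y≋i·d)))
           ]′ y-x≋±i·d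
    where
    negate : ∀ a b → b - a ≡ - (a - b)
    negate = solve-∀
    y-x≉0 : + toℕ y - + toℕ x ≉ + 0
    y-x≉0 y-x≋0 = x≢y (Finₚ.toℕ-injective
                    (canonical (Finₚ.toℕ<n x) (Finₚ.toℕ<n y) (≋-sym (-≋0⇒≋ y-x≋0))))

-- The counting lower bound C(q, 2) ≤ k · |s| for a q-ary k-radius sequence
-- s: each ordered pair of distinct symbols is carried by an ordered pair of
-- distinct positions at distance ≤ k, which is a position together with
-- one of 2k offsets, and different symbol pairs need different positions.
module Counting where

  open Nat using (_+_; _*_; _∸_; _≤_; _<_)
  open import Data.List.Base using (List; length; lookup)
  open import Data.Fin.Base using (Fin; toℕ; fromℕ<; splitAt; combine; remQuot; _↑ˡ_; _↑ʳ_)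
  import Data.Fin.Properties as Finₚ
  open import Data.Nat.Combinatorics using (_C_; nCk+nC[k+1]≡[n+1]C[k+1]; nC1≡n)
  open import Function.Definitions using (Injective)
  import Data.Nat.Tactic.RingSolver as ℕ-Solver

  -- The offset of position v from position u ≢ v, |u - v| ≤ k, in the left
  -- half of Fin (k + k) if v > u and in the right half if v < u.
  private
    gap : ∀ {k a b} → a < b → Nat.∣ a - b ∣ ≤ k → b ∸ suc a < k
    gap {k} {a} {b} a<b ∣a-b∣≤k =
      subst (_≤ k) (trans (ℕₚ.m≤n⇒∣m-n∣≡n∸m (ℕₚ.<⇒≤ a<b)) (ℕₚ.+-∸-assoc 1 a<b)) ∣a-b∣≤k

    below : ∀ {u v} → u ≢ v → ¬ u < v → v < u
    below u≢v u≮v = ℕₚ.≤∧≢⇒< (ℕₚ.≮⇒≥ u≮v) (u≢v ∘ sym)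

    gap′ : ∀ {k u v} (u≢v : u ≢ v) (u≮v : ¬ u < v) → Nat.∣ u - v ∣ ≤ k → u ∸ suc v < k
    gap′ {k} {u} {v} u≢v u≮v near = gap (below u≢v u≮v) (subst (_≤ k) (ℕₚ.∣-∣-comm u v) near)

  offset : ∀ k (u v : ℕ) → u ≢ v → Nat.∣ u - v ∣ ≤ k → Fin (k + k)
  offset k u v u≢v near with u ℕₚ.<? v
  ... | yes u<v = fromℕ< (gap u<v near) ↑ˡ k
  ... | no  u≮v = k ↑ʳ fromℕ< (gap′ u≢v u≮v near)

  partner : ∀ k → ℕ → Fin (k + k) → ℕ
  partner k u o = Sum.[ (λ δ → u + suc (toℕ δ)) , (λ δ → u ∸ suc (toℕ δ)) ]′ (splitAt k o)

  partner-offset : ∀ k u v u≢v near → partner k u (offset k u v u≢v near) ≡ v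
  partner-offset k u v u≢v near with u ℕₚ.<? v
  ... | yes u<v rewrite Finₚ.splitAt-↑ˡ k (fromℕ< (gap u<v near)) k
                      | Finₚ.toℕ-fromℕ< (gap u<v near) =
    trans (cong (u +_) (sym (ℕₚ.+-∸-assoc 1 u<v))) (ℕₚ.m+[n∸m]≡n (ℕₚ.<⇒≤ u<v))
  ... | no  u≮v rewrite Finₚ.splitAt-↑ʳ k k (fromℕ< (gap′ u≢v u≮v near))
                      | Finₚ.toℕ-fromℕ< (gap′ u≢v u≮v near) =
    trans (cong (u ∸_) (sym (ℕₚ.+-∸-assoc 1 (below u≢v u≮v))))
          (ℕₚ.m∸[m∸n]≡n (ℕₚ.<⇒≤ (below u≢v u≮v)))

  double-C2 : ∀ n → 2 * (n C 2) ≡ n * (n ∸ 1)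
  double-C2 zero    = refl
  double-C2 (suc n) = begin
    2 * (suc n C 2)              ≡⟨ cong (2 *_) (nCk+nC[k+1]≡[n+1]C[k+1] n 1) ⟨
    2 * (n C 1 + n C 2)          ≡⟨ cong (λ c → 2 * (c + n C 2)) (nC1≡n n) ⟩
    2 * (n + n C 2)              ≡⟨ ℕₚ.*-distribˡ-+ 2 n (n C 2) ⟩
    2 * n + 2 * (n C 2)          ≡⟨ cong (2 * n +_) (double-C2 n) ⟩
    2 * n + n * (n ∸ 1)          ≡⟨ step n ⟩
    suc n * n                    ∎
    where
    open ≡-Reasoning
    step : ∀ n → 2 * n + n * (n ∸ 1) ≡ suc n * n
    step zero    = refl
    step (suc n) = ring n
      where ring : ∀ n → 2 * suc n + suc n * n ≡ suc (suc n) * suc n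
            ring = ℕ-Solver.solve-∀

  module _ {q k} (s : List (Fin q)) (radius : IsRadiusSeq q k s) where

    private
      N = length s
      open Adjacency using (Adjacent)

    near-code : ∀ {x y} → x ≢ y → Adjacent k s x y → Fin (N * (k + k))
    near-code x≢y (i , j , sᵢ≡x , sⱼ≡y , near) = combine i (offset k (toℕ i) (toℕ j) i≢j near)
      where i≢j = λ i≡j → x≢y (trans (sym sᵢ≡x) (trans (cong (lookup s) (Finₚ.toℕ-injective i≡j)) sⱼ≡y))

    -- The code determines both positions, hence both symbols.
    near-code-injective : ∀ {x y x′ y′} (x≢y : x ≢ y) (x′≢y′ : x′ ≢ y′) w w′ →
                          near-code x≢y w ≡ near-code x′≢y′ w′ → x ≡ x′ × y ≡ y′
    near-code-injective x≢y x′≢y′ (i , j , sᵢ≡x , sⱼ≡y , near) (i′ , j′ , sᵢ′≡x′ , sⱼ′≡y′ , near′) eq =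
      same sᵢ≡x sᵢ′≡x′ i≡i′ , same sⱼ≡y sⱼ′≡y′ (Finₚ.toℕ-injective toℕj≡toℕj′)
      where
      same : ∀ {a a′ z z′} → lookup s a ≡ z → lookup s a′ ≡ z′ → a ≡ a′ → z ≡ z′
      same sₐ≡z sₐ′≡z′ a≡a′ = trans (sym sₐ≡z) (trans (cong (lookup s) a≡a′) sₐ′≡z′)
      i≡i′ = Finₚ.combine-injectiveˡ i _ i′ _ eq
      o≡o′ = Finₚ.combine-injectiveʳ i _ i′ _ eq
      toℕj≡toℕj′ : toℕ j ≡ toℕ j′
      toℕj≡toℕj′ = trans (sym (partner-offset k (toℕ i) (toℕ j) _ near))
                   (trans (cong₂ (partner k) (cong toℕ i≡i′) o≡o′)
                          (partner-offset k (toℕ i′) (toℕ j′) _ near′))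

    private
      ↑ʳ≢↑ˡ : ∀ {m n} (i : Fin n) (j : Fin m) → m ↑ʳ i ≢ j ↑ˡ n
      ↑ʳ≢↑ˡ {m} {n} i j eq
        with trans (sym (Finₚ.splitAt-↑ʳ m n i)) (trans (cong (splitAt m) eq) (Finₚ.splitAt-↑ˡ m j n))
      ... | ()

    code : Fin q × Fin q → Fin (N * (k + k) + q)
    code (x , y) with x Finₚ.≟ y
    ... | yes _   = N * (k + k) ↑ʳ x
    ... | no  x≢y = near-code x≢y (radius x y x≢y) ↑ˡ q

    code-injective : ∀ {a b} → code a ≡ code b → a ≡ b
    code-injective {x , y} {x′ , y′} eq with x Finₚ.≟ y | x′ Finₚ.≟ y′
    ... | yes x≡y | yes x′≡y′ = let x≡x′ = Finₚ.↑ʳ-injective (N * (k + k)) x x′ eq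
                                in cong₂ _,_ x≡x′ (trans (sym x≡y) (trans x≡x′ x′≡y′))
    ... | yes _   | no  _     = ⊥-elim (↑ʳ≢↑ˡ _ _ eq)
    ... | no  _   | yes _     = ⊥-elim (↑ʳ≢↑ˡ _ _ (sym eq))
    ... | no  x≢y | no  x′≢y′ = let x≡x′ , y≡y′ = near-code-injective x≢y x′≢y′
                                                     (radius x y x≢y) (radius x′ y′ x′≢y′)
                                                     (Finₚ.↑ˡ-injective q _ _ eq)
                                in cong₂ _,_ x≡x′ y≡y′

    square-bound : q * q ≤ N * (k + k) + q
    square-bound = Finₚ.injective⇒≤ {f = code ∘ remQuot {q} q} λ {c} {c′} eq →
      trans (sym (Finₚ.combine-remQuot {q} q c))
            (trans (cong (λ (a , b) → combine a b) (code-injective eq)) (Finₚ.combine-remQuot {q} q c′))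

    radius-lower-bound : q C 2 ≤ k * N
    radius-lower-bound = ℕₚ.*-cancelˡ-≤ 2 (ℕₚ.+-cancelʳ-≤ q _ _ (begin
      2 * (q C 2) + q       ≡⟨ cong (_+ q) (double-C2 q) ⟩
      q * (q ∸ 1) + q       ≡⟨ square q ⟨
      q * q                 ≤⟨ square-bound ⟩
      N * (k + k) + q       ≡⟨ cong (_+ q) (twice k N) ⟩
      2 * (k * N) + q       ∎))
      where
      open ℕₚ.≤-Reasoning
      square : ∀ q → q * q ≡ q * (q ∸ 1) + q
      square zero    = refl
      square (suc q) = ring q
        where ring : ∀ q → suc q * suc q ≡ suc q * q + suc q
              ring = ℕ-Solver.solve-∀
      twice : ∀ k N → N * (k + k) ≡ 2 * (k * N)
      twice = ℕ-Solver.solve-∀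

-- Shortest radius sequences exist as soon as some radius sequence exists:
-- being a radius sequence is decidable, so is the existence of one of a
-- given length (there are finitely many lists), and a decidable property
-- of ℕ that holds somewhere holds at a least point.
module Shortest where

  open Nat using (_≤_)
  open import Data.List.Base using (List; []; _∷_; length; lookup)
  open import Data.Fin.Base using (Fin; toℕ)
  import Data.Fin.Properties as Finₚ
  open import Relation.Nullary.Decidable using (_×-dec_; _→-dec_; ¬?)

  least : (Q : ℕ → Set) → (∀ n → Dec (Q n)) → ∀ L → Q L → ∃[ m ] (Q m × (∀ n → Q n → m ≤ n))
  least Q Q? zero    Q0  = 0 , Q0 , λ _ _ → z≤n
  least Q Q? (suc L) QsL with Q? 0
  ... | yes Q0  = 0 , Q0 , λ _ _ → z≤n
  ... | no  ¬Q0 with least (Q ∘ suc) (Q? ∘ suc) L QsL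
  ... | m , Qsm , minimal = suc m , Qsm , above
    where
    above : ∀ n → Q n → suc m ≤ n
    above zero    Q0  = ⊥-elim (¬Q0 Q0)
    above (suc n) Qsn = s≤s (minimal n Qsn)

  isRadiusSeq? : ∀ n k s → Dec (IsRadiusSeq n k s)
  isRadiusSeq? n k s = Finₚ.all? λ x → Finₚ.all? λ y → ¬? (x Finₚ.≟ y) →-dec
    Finₚ.any? λ i → Finₚ.any? λ j →
      (lookup s i Finₚ.≟ x) ×-dec (lookup s j Finₚ.≟ y) ×-dec (Nat.∣ toℕ i - toℕ j ∣ ℕₚ.≤? k)

  exists-of-length? : ∀ {q} (P : List (Fin q) → Set) → (∀ s → Dec (P s)) → ∀ L →
                      Dec (∃[ s ] (P s × length s ≡ L))
  exists-of-length? P P? zero with P? []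
  ... | yes P[] = yes ([] , P[] , refl)
  ... | no ¬P[] = no λ where ([] , P[] , _) → ¬P[] P[]
  exists-of-length? P P? (suc L)
    with Finₚ.any? (λ a → exists-of-length? (P ∘ (a ∷_)) (P? ∘ (a ∷_)) L)
  ... | yes (a , s , Pas , refl) = yes (a ∷ s , Pas , refl)
  ... | no  none = no λ where (a ∷ s , Pas , refl) → none (a , s , Pas , refl)

  shortest : ∀ q k L → ∃[ s ] (IsRadiusSeq q k s × length s ≡ L) →
             ∃[ m ] ((∃[ s ] (IsRadiusSeq q k s × length s ≡ m))
                    × ((s : List (Fin q)) → IsRadiusSeq q k s → m ≤ length s))
  shortest q k L witness =
    let m , sequence-of-m , minimal = least HasLength (exists-of-length? _ (isRadiusSeq? q k)) L witness
    in m , sequence-of-m , λ s radius → minimal (length s) (s , radius , refl)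
    where
    HasLength : ℕ → Set
    HasLength m = ∃[ s ] (IsRadiusSeq q k s × length s ≡ m)

module RadiusPrime (k : ℕ) .{{_ : Nat.NonZero k}} (p : ℕ) (radius-prime : IsRadiusPrime k p) where

  open Nat using (_+_; _*_; _∸_; _/_; _≤_; _<_)
  open import Data.List.Base using (List; length)
  open import Data.Fin.Base using (Fin)
  open import Data.Nat.Combinatorics using (_C_)
  import Data.Nat.Tactic.RingSolver as ℕ-Solver

  prime : Prime p
  prime = proj₁ radius-prime

  0<k : 0 < k
  0<k = Nat.>-nonZero⁻¹ k

  private
    2k∣p-1 : 2 * k ℕ∣.∣ p ∸ 1
    2k∣p-1 = subst (2 * k ℕ∣.∣_) (ℕₚ.m≤n⇒∣n-m∣≡n∸m (ℕₚ.<⇒≤ (PrimeFacts.1<p p prime)))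
               (proj₁ (proj₂ radius-prime))

  t : ℕ
  t = ℕ∣._∣_.quotient 2k∣p-1

  p-1≡2kt : p ∸ 1 ≡ 2 * (k * t)
  p-1≡2kt = trans (ℕ∣._∣_.equality 2k∣p-1) (rearrange t k)
    where rearrange : ∀ t k → t * (2 * k) ≡ 2 * (k * t)
          rearrange = ℕ-Solver.solve-∀

  0<t : 0 < t
  0<t = ℕₚ.n≢0⇒n>0 λ t≡0 → ℕₚ.<⇒≢ (ℕₚ.m<n⇒0<n∸m (PrimeFacts.1<p p prime)) (sym (begin
    p ∸ 1          ≡⟨ p-1≡2kt ⟩
    2 * (k * t)    ≡⟨ cong (λ n → 2 * (k * n)) t≡0 ⟩
    2 * (k * 0)    ≡⟨ cong (2 *_) (ℕₚ.*-zeroʳ k) ⟩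
    0              ∎))
    where open ≡-Reasoning

  exponent≡2t : (p ∸ 1) / k ≡ 2 * t
  exponent≡2t = trans (cong (_/ k) (trans p-1≡2kt (rearrange k t))) (NatDM.m*n/n≡m (2 * t) k)
    where rearrange : ∀ k t → 2 * (k * t) ≡ 2 * t * k
          rearrange = ℕ-Solver.solve-∀

  distinct-powers : ∀ a b → 1 ≤ a → a ≤ k → 1 ≤ b → b ≤ k → a ≢ b →
                    Congruence._≉_ p ((Int.+ a) Int.^ (2 * t)) ((Int.+ b) Int.^ (2 * t))
  distinct-powers a b 1≤a a≤k 1≤b b≤k a≢b aᵉ≋bᵉ =
    proj₂ (proj₂ radius-prime) a b 1≤a a≤k 1≤b b≤k a≢b
      (subst (λ e → ModEq p (a Nat.^ e) (b Nat.^ e)) (sym exponent≡2t)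
        (Congruence.≋⇒ModEq p (subst₂ (Congruence._≋_ p) (sym (Powers.+-^ a (2 * t)))
                                                         (sym (Powers.+-^ b (2 * t))) aᵉ≋bᵉ)))

  open RadiusSequence p prime k t 0<k 0<t p-1≡2kt distinct-powers public
    using (sequence; is-radius-sequence; length-sequence; B)

  L : ℕ
  L = t * B + 1

  length≡L : (p ∸ 1) / k / 2 * (p + k ∸ 1) + 1 ≡ L
  length≡L = cong₂ (λ a b → a * b + 1)
    (trans (cong (_/ 2) exponent≡2t) (trans (cong (_/ 2) (ℕₚ.*-comm 2 t)) (NatDM.m*n/n≡m t 2)))
    (ℕₚ.+-∸-comm k (ℕₚ.<⇒≤ (PrimeFacts.1<p p prime)))

  -- k L ≤ C(p, 2) + k p, since C(p, 2) = p · kt and p = 2kt + 1.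
  kL≤C+kp : k * L ≤ p C 2 + k * p
  kL≤C+kp = subst (k * L ≤_) (sym expand) (ℕₚ.m≤m+n (k * L) (k * t + k * k * t))
    where
    open ≡-Reasoning
    p≡1+2kt : p ≡ suc (2 * (k * t))
    p≡1+2kt = trans (PrimeFacts.p≡1+[p-1] p prime) (cong suc p-1≡2kt)
    C≡p·kt : p C 2 ≡ p * (k * t)
    C≡p·kt = ℕₚ.*-cancelˡ-≡ _ _ 2 (begin
      2 * (p C 2)         ≡⟨ Counting.double-C2 p ⟩
      p * (p ∸ 1)         ≡⟨ cong (p *_) p-1≡2kt ⟩
      p * (2 * (k * t))   ≡⟨ ℕₚ.*-assoc p 2 (k * t) ⟨
      p * 2 * (k * t)     ≡⟨ cong (_* (k * t)) (ℕₚ.*-comm p 2) ⟩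
      2 * p * (k * t)     ≡⟨ ℕₚ.*-assoc 2 p (k * t) ⟩
      2 * (p * (k * t))   ∎)
    identity : ∀ k t → suc (2 * (k * t)) * (k * t) + k * suc (2 * (k * t))
                       ≡ k * (t * (2 * (k * t) + k) + 1) + (k * t + k * k * t)
    identity = ℕ-Solver.solve-∀
    expand : p C 2 + k * p ≡ k * L + (k * t + k * k * t)
    expand = begin
      p C 2 + k * p                  ≡⟨ cong (_+ k * p) C≡p·kt ⟩
      p * (k * t) + k * p            ≡⟨ cong (λ q → q * (k * t) + k * q) p≡1+2kt ⟩
      suc (2 * (k * t)) * (k * t) + k * suc (2 * (k * t)) ≡⟨ identity k t ⟩
      k * (t * (2 * (k * t) + k) + 1) + (k * t + k * k * t)
                                     ≡⟨ cong (λ b → k * (t * (b + k) + 1) + (k * t + k * k * t)) (sym p-1≡2kt) ⟩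
      k * L + (k * t + k * k * t)    ∎

  -- The shortest p-ary k-radius sequence has length m with
  -- C(p, 2) ≤ k m ≤ k L ≤ C(p, 2) + k p.
  shortest-length-estimate :
    ∃[ m ] ((∃[ s ] (IsRadiusSeq p k s × length s ≡ m))
      × ((s : List (Fin p)) → IsRadiusSeq p k s → m ≤ length s)
      × Nat.∣ k * m - p C 2 ∣ ≤ k * p)
  shortest-length-estimate = m , shortest-sequence , minimal , estimate
    where
    shortest = Shortest.shortest p k L (sequence t , is-radius-sequence , length-sequence)
    m = proj₁ shortest
    shortest-sequence = proj₁ (proj₂ shortest)
    minimal = proj₂ (proj₂ shortest)
    C≤km : p C 2 ≤ k * m
    C≤km = subst (λ n → p C 2 ≤ k * n) (proj₂ (proj₂ shortest-sequence))
             (Counting.radius-lower-bound (proj₁ shortest-sequence) (proj₁ (proj₂ shortest-sequence)))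
    km≤C+kp : k * m ≤ p C 2 + k * p
    km≤C+kp = ℕₚ.≤-trans (ℕₚ.*-monoʳ-≤ k m≤L) kL≤C+kp
      where m≤L = subst (m ≤_) length-sequence (minimal (sequence t) is-radius-sequence)
    estimate : Nat.∣ k * m - p C 2 ∣ ≤ k * p
    estimate = subst (_≤ k * p) (sym (ℕₚ.m≤n⇒∣n-m∣≡n∸m C≤km))
                 (ℕₚ.m≤n+o⇒m∸n≤o (k * m) (p C 2) km≤C+kp)

open import Data.Nat using (ℕ; _+_; _*_; _∸_; _≤_; NonZero; ∣_-_∣)
open import Data.Nat.DivMod using (_/_)
open import Data.Nat.Combinatorics using (_C_)
open import Data.Fin using (Fin)
open import Data.List using (List; length)

proposition7p1 : (k : ℕ) → .{{_ : NonZero k}} →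
    ((p : ℕ) → IsRadiusPrime k p →
      ∃[ s ] (IsRadiusSeq p k s × length s ≡ (p ∸ 1) / k / 2 * (p + k ∸ 1) + 1))
    × (∃[ c ] ((p : ℕ) → IsRadiusPrime k p →
        ∃[ m ] ((∃[ s ] (IsRadiusSeq p k s × length s ≡ m))
          × ((s : List (Fin p)) → IsRadiusSeq p k s → m ≤ length s)
          × ∣ k * m - (p C 2) ∣ ≤ c * p)))
proposition7p1 k = construction , k , asymptotics
  where
  construction : (p : ℕ) → IsRadiusPrime k p →
    ∃[ s ] (IsRadiusSeq p k s × length s ≡ (p ∸ 1) / k / 2 * (p + k ∸ 1) + 1)
  construction p radius-prime =
    sequence t , is-radius-sequence , trans length-sequence (sym length≡L)
    where open RadiusPrime k p radius-prime

  asymptotics : (p : ℕ) → IsRadiusPrime k p →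
    ∃[ m ] ((∃[ s ] (IsRadiusSeq p k s × length s ≡ m))
      × ((s : List (Fin p)) → IsRadiusSeq p k s → m ≤ length s)
      × ∣ k * m - (p C 2) ∣ ≤ k * p)
  asymptotics p radius-prime = shortest-length-estimate
    where open RadiusPrime k p radius-prime
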